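{- Let $C=\{(2,2),(2,3),(3,2),(3,3)\}$. For each of the following sets $T$, with $R=C\cup T$, we have $(123,R)\sim_d(132,R)$: (1) $T=\{(0,0)\}$; (2) $T=\{(0,1),(1,0)\}$; (3) $T=\{(0,0),(0,1),(1,0)\}$; (4) $T=\{(1,1)\}$; (5) $T=\{(0,0),(1,1)\}$; (6) $T=\{(0,1),(1,0),(1,1)\}$; (7) $T=\{(0,0),(0,1),(1,0),(1,1)\}$.
   Context: $S_n$ denotes the set of permutations of $[n]=\{1,\dots,n\}$, written $\pi=\pi_1\cdots\pi_n$. A mesh pattern of length $k$ is a pair $(\tau,R)$ with $\tau\in S_k$ and $R\subseteq\{0,1,\dots,k\}^2$ (the shaded boxes; box $(a,b)$ is the unit square $[a,a+1]\times[b,b+1]$ in the diagram of $\tau$). An occurrence of $(\tau,R)$ in $\pi\in S_n$ is a choice of indices $i_1<\dots<i_k$ such that $\pi_{i_1}\cdots\pi_{i_k}$ is order-isomorphic to $\tau$ and, with $i_0=0$, $i_{k+1}=n+1$, $v_1<\dots<v_k$ the values $\pi_{i_1},\dots,\pi_{i_k}$ sorted increasingly, $v_0=0$, $v_{k+1}=n+1$, for every $(a,b)\in R$ there is no index $m$ with $i_a<m<i_{a+1}$ and $v_b<\pi_m<v_{b+1}$. Mesh patterns $p,q$ are equidistributed, $p\sim_d q$, if for all $n,\ell\ge0$ the number of $\pi\in S_n$ with exactly $\ell$ occurrences of $p$ equals the number with exactly $\ell$ occurrences of $q$. -}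

module Defs where

open import Data.Nat using (ℕ; zero; suc; _+_; _<ᵇ_; _≡ᵇ_)
open import Data.Nat.Properties using (≤-decTotalOrder)
open import Data.Bool using (Bool; true; false; _∧_; not)
open import Data.Fin using (Fin; toℕ)
import Data.Fin as Fin
open import Data.Vec using (Vec; []; _∷_; lookup; toList)
open import Data.List using (List; []; _∷_; [_]; _++_; map; concatMap; length; filterᵇ; allFin)
open import Data.Product using (_×_; _,_)
open import Relation.Binary.PropositionalEquality using (_≡_)
open import Data.List.Sort.MergeSort ≤-decTotalOrder using (sort)

_∨'_ : Bool → Bool → Bool
true ∨' _ = true
false ∨' b = b

_⇔ᵇ_ : Bool → Bool → Bool
true ⇔ᵇ b = b
false ⇔ᵇ b = not b

allᵇ : {A : Set} → (A → Bool) → List A → Bool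
allᵇ p [] = true
allᵇ p (x ∷ xs) = p x ∧ allᵇ p xs

anyᵇ : {A : Set} → (A → Bool) → List A → Bool
anyᵇ p [] = false
anyᵇ p (x ∷ xs) = p x ∨' anyᵇ p xs

vecs : (k n : ℕ) → List (Vec (Fin n) k)
vecs zero n = [ [] ]
vecs (suc k) n = concatMap (λ x → map (x ∷_) (vecs k n)) (allFin n)

-- A permutation π ∈ S_n is represented by the vector (π_1 - 1, …, π_n - 1) ∈ Fin n ^ n
-- with pairwise distinct entries.
isPerm : {n : ℕ} → Vec (Fin n) n → Bool
isPerm {n} v = allᵇ (λ i → allᵇ (λ j → (toℕ i ≡ᵇ toℕ j) ∨' not (toℕ (lookup v i) ≡ᵇ toℕ (lookup v j))) (allFin n)) (allFin n)

Perms : (n : ℕ) → List (Vec (Fin n) n)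
Perms n = filterᵇ isPerm (vecs n n)

-- 1-based value π_m and position m
val : {n : ℕ} → Vec (Fin n) n → Fin n → ℕ
val π m = suc (toℕ (lookup π m))

pos : {n : ℕ} → Fin n → ℕ
pos m = suc (toℕ m)

nth : List ℕ → ℕ → ℕ
nth [] _ = 0
nth (x ∷ xs) zero = x
nth (x ∷ xs) (suc j) = nth xs j

-- A mesh pattern (τ , R) of length k: τ ∈ S_k (same representation), R a list of boxes (a , b).
record MeshPattern : Set where
  constructor mesh
  field
    k : ℕ
    τ : Vec (Fin k) k
    R : List (ℕ × ℕ)

isOcc : {n : ℕ} → (p : MeshPattern) → Vec (Fin n) n → Vec (Fin n) (MeshPattern.k p) → Bool
isOcc {n} (mesh k τ R) π is = increasing ∧ (orderIso ∧ shading)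
  where
  ks : List (Fin k)
  ks = allFin k
  ix : Fin k → Fin n
  ix a = lookup is a
  increasing : Bool
  increasing = allᵇ (λ a → allᵇ (λ b → not (toℕ a <ᵇ toℕ b) ∨' (toℕ (ix a) <ᵇ toℕ (ix b))) ks) ks
  orderIso : Bool
  orderIso = allᵇ (λ a → allᵇ (λ b → (val π (ix a) <ᵇ val π (ix b)) ⇔ᵇ (toℕ (lookup τ a) <ᵇ toℕ (lookup τ b))) ks) ks
  -- I j = i_j with i_0 = 0, i_{k+1} = n + 1 (1-based positions)
  I : List ℕ
  I = 0 ∷ map pos (toList is) ++ [ suc n ]
  -- V j = v_j : values sorted increasingly, v_0 = 0, v_{k+1} = n + 1
  V : List ℕ
  V = 0 ∷ sort (map (val π) (toList is)) ++ [ suc n ]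
  box : ℕ × ℕ → Bool
  box (a , b) = not (anyᵇ (λ m → (nth I a <ᵇ pos m) ∧ ((pos m <ᵇ nth I (suc a)) ∧ ((nth V b <ᵇ val π m) ∧ (val π m <ᵇ nth V (suc b))))) (allFin n))
  shading : Bool
  shading = allᵇ box R

occ : {n : ℕ} → MeshPattern → Vec (Fin n) n → ℕ
occ {n} p π = length (filterᵇ (isOcc p π) (vecs (MeshPattern.k p) n))

numWith : MeshPattern → (n ℓ : ℕ) → ℕ
numWith p n ℓ = length (filterᵇ (λ π → occ p π ≡ᵇ ℓ) (Perms n))

Equidistributed : MeshPattern → MeshPattern → Set
Equidistributed p q = (n ℓ : ℕ) → numWith p n ℓ ≡ numWith q n ℓ

τ123 : Vec (Fin 3) 3
τ123 = Fin.zero ∷ Fin.suc Fin.zero ∷ Fin.suc (Fin.suc Fin.zero) ∷ []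

τ132 : Vec (Fin 3) 3
τ132 = Fin.zero ∷ Fin.suc (Fin.suc Fin.zero) ∷ Fin.suc Fin.zero ∷ []

C : List (ℕ × ℕ)
C = (2 , 2) ∷ (2 , 3) ∷ (3 , 2) ∷ (3 , 3) ∷ []

Ts : List (List (ℕ × ℕ))
Ts = ((0 , 0) ∷ [])
   ∷ ((0 , 1) ∷ (1 , 0) ∷ [])
   ∷ ((0 , 0) ∷ (0 , 1) ∷ (1 , 0) ∷ [])
   ∷ ((1 , 1) ∷ [])
   ∷ ((0 , 0) ∷ (1 , 1) ∷ [])
   ∷ ((0 , 1) ∷ (1 , 0) ∷ (1 , 1) ∷ [])
   ∷ ((0 , 0) ∷ (0 , 1) ∷ (1 , 0) ∷ (1 , 1) ∷ [])
   ∷ []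

-- With the four boxes of C shaded, an occurrence (x, y, z) of 123 or of 132 forces π_y and π_z
-- to be the two largest entries of π at positions ≥ y, and the shaded boxes of T ⊆ {0,1}² only
-- see the entries left of y and below min(π_y, π_z). Call k the partner of m when π_m and π_k
-- (m < k) are the two largest entries at positions ≥ m. Swapping π_m with its partner turns the
-- occurrences of 123 with middle position m into those of 132 and back, and keeps (up to moving
-- z) the occurrences of 123 with middle position < m and those of 132 with middle position > m.
-- Hence, if h_j(π) counts the occurrences of 123 with middle position < j and of 132 with
-- middle position ≥ j, the involution of S_n "swap π_m with its partner, if there is one"
-- carries h_{m+1} to h_m. So all h_j have the same distribution, and h_n, h_0 count the
-- occurrences of the two patterns.

module Submission where

open import Defs
open import Data.Bool using (Bool; true; false; _∧_; not; T; if_then_else_)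
open import Data.Bool.Properties using (T-∧; T-≡; T-not-≡)
open import Data.Empty using (⊥-elim)
open import Data.Fin using (Fin; toℕ; fromℕ<; _<_; _≤_)
open import Data.Fin.Patterns using (0F; 1F; 2F)
open import Data.Fin.Permutation.Components using (transpose)
open import Data.Fin.Properties
  using (toℕ-injective; toℕ<n; toℕ-fromℕ<; _≟_; _<?_; <-cmp; <⇒≢; any?; all?)
open import Data.List
  using (List; []; _∷_; [_]; _++_; map; concatMap; cartesianProductWith; allFin; length; filterᵇ)
open import Data.List.Properties using (map-cong; concatMap-map; concatMap-pure)
open import Data.List.Membership.Propositional using (_∈_)
open import Data.List.Membership.Propositional.Properties
  using (∈-map⁺; ∈-map⁻; ∈-allFin; ∈-filter⁺; ∈-filter⁻; ∈-cartesianProductWith⁺)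
open import Data.List.Membership.Propositional.Properties.WithK using (unique∧set⇒bag)
open import Data.List.Relation.Binary.BagAndSetEquality using (∼bag⇒↭)
open import Data.List.Relation.Binary.Permutation.Propositional using (_↭_)
import Data.List.Relation.Binary.Permutation.Propositional.Properties as ↭
open import Data.List.Relation.Unary.All as All using (All; []; _∷_)
import Data.List.Relation.Unary.All.Properties as Allₚ
import Data.List.Relation.Unary.AllPairs as AllPairs
open import Data.List.Relation.Unary.Any using (here; there)
open import Data.List.Relation.Unary.Unique.Propositional using (Unique)
import Data.List.Relation.Unary.Unique.Propositional.Properties as Unique
open import Data.Nat
  using (ℕ; zero; suc; _+_; _<ᵇ_; _≤ᵇ_; _≡ᵇ_; z≤n; s≤s; z<s; s<s; s≤s⁻¹; s<s⁻¹)
  renaming (_<_ to _<ℕ_; _≤_ to _≤ℕ_)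
open import Data.Nat.ListAction using (sum)
open import Data.Nat.Properties
  using ( ≤-decTotalOrder; _≤?_; ≡ᵇ⇒≡; ≡⇒≡ᵇ; <ᵇ⇒<; <⇒<ᵇ; ≤⇒≤ᵇ; ≤ᵇ⇒≤
        ; ≤-refl; <-irrefl; <-asym; <-trans; <-≤-trans; ≤-<-trans; <⇒≤; <⇒≱; m<n⇒m<1+n; n<1+n)
open import Data.List.Sort.MergeSort ≤-decTotalOrder using (sort)
open import Data.Product using (_×_; _,_; proj₁; proj₂; ∃)
open import Data.Sum using (_⊎_; inj₁; inj₂)
open import Data.Unit using (tt)
open import Data.Vec using (Vec; []; _∷_; lookup; tabulate; toList)
open import Data.Vec.Properties using (lookup∘tabulate; tabulate-cong; tabulate∘lookup; ∷-injective)
open import Function using (_∘_; id; _⇔_; mk⇔; Equivalence)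
open import Function.Definitions using (Injective)
open import Relation.Binary.Definitions using (tri<; tri≈; tri>)
open import Relation.Binary.PropositionalEquality
  using (_≡_; _≢_; refl; sym; trans; cong; subst; subst₂; ≢-sym; module ≡-Reasoning)
open import Relation.Nullary using (¬_; yes; no)
open import Relation.Nullary.Decidable using (Dec; T?; ¬?; _×-dec_; _→-dec_; from-yes)

open Equivalence using (to; from)

private variable
  A : Set
  n k : ℕ

T-allᵇ : {p : A → Bool} (xs : List A) → T (allᵇ p xs) ⇔ All (T ∘ p) xs
T-allᵇ []       = mk⇔ (λ _ → []) (λ _ → tt)
T-allᵇ (x ∷ xs) = mk⇔
  (λ t → let px , pxs = to T-∧ t in px ∷ to (T-allᵇ xs) pxs)
  (λ { (px ∷ pxs) → from T-∧ (px , from (T-allᵇ xs) pxs) })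

T-allᵇ-allFin : {p : Fin n → Bool} → T (allᵇ p (allFin n)) ⇔ (∀ i → T (p i))
T-allᵇ-allFin {n} = mk⇔ (Allₚ.tabulate⁻ ∘ to (T-allᵇ (allFin n))) (from (T-allᵇ (allFin n)) ∘ Allₚ.tabulate⁺)

T-allᵇ-allFin² : {p : Fin n → Fin n → Bool} →
                 T (allᵇ (λ i → allᵇ (p i) (allFin n)) (allFin n)) ⇔ (∀ i j → T (p i j))
T-allᵇ-allFin² {n} {p} = mk⇔
  (λ t i → to T-allᵇ-allFin (to (T-allᵇ-allFin {p = row}) t i))
  (λ t → from (T-allᵇ-allFin {p = row}) λ i → from T-allᵇ-allFin (t i))
  where
  row : Fin n → Bool
  row i = allᵇ (p i) (allFin n)

not-anyᵇ : (p : A → Bool) (xs : List A) → not (anyᵇ p xs) ≡ allᵇ (not ∘ p) xs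
not-anyᵇ p []       = refl
not-anyᵇ p (x ∷ xs) with p x
... | true  = refl
... | false = not-anyᵇ p xs

T-not : {b : Bool} → T (not b) ⇔ (¬ T b)
T-not {false} = mk⇔ (λ _ ()) (λ _ → tt)
T-not {true}  = mk⇔ (λ ()) (λ f → f tt)

T-not-∨' : {a b : Bool} → T (not a ∨' b) ⇔ (T a → T b)
T-not-∨' {false} = mk⇔ (λ _ ()) (λ _ → tt)
T-not-∨' {true}  = mk⇔ (λ t _ → t) (λ f → f tt)

T-∨'-not : {a b : Bool} → T (b ∨' not a) ⇔ (T a → T b)
T-∨'-not {false} {true}  = mk⇔ (λ _ ()) (λ _ → tt)
T-∨'-not {false} {false} = mk⇔ (λ _ ()) (λ _ → tt)
T-∨'-not {true}  {true}  = mk⇔ (λ _ _ → tt) (λ _ → tt)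
T-∨'-not {true}  {false} = mk⇔ (λ ()) (λ f → f tt)

T-⇔ᵇ : {a b : Bool} → T (a ⇔ᵇ b) ⇔ (T a ⇔ T b)
T-⇔ᵇ {true}  {true}  = mk⇔ (λ _ → mk⇔ _ _) (λ _ → tt)
T-⇔ᵇ {true}  {false} = mk⇔ (λ ()) (λ e → to e tt)
T-⇔ᵇ {false} {true}  = mk⇔ (λ ()) (λ e → from e tt)
T-⇔ᵇ {false} {false} = mk⇔ (λ _ → mk⇔ (λ ()) (λ ())) (λ _ → tt)

T-⇔⇒≡ : {a b : Bool} → (T a ⇔ T b) → a ≡ b
T-⇔⇒≡ {false} {false} _ = refl
T-⇔⇒≡ {false} {true}  e = ⊥-elim (from e tt)
T-⇔⇒≡ {true}  {false} e = ⊥-elim (to e tt)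
T-⇔⇒≡ {true}  {true}  _ = refl

T-<ᵇ : {a b : ℕ} → T (a <ᵇ b) ⇔ a <ℕ b
T-<ᵇ {a} {b} = mk⇔ (<ᵇ⇒< a b) <⇒<ᵇ

<ᵇ-true : {a b : ℕ} → a <ℕ b → (a <ᵇ b) ≡ true
<ᵇ-true = to T-≡ ∘ <⇒<ᵇ

<ᵇ-false : {a b : ℕ} → ¬ a <ℕ b → (a <ᵇ b) ≡ false
<ᵇ-false {a} {b} a≮b = to T-not-≡ (from T-not (a≮b ∘ <ᵇ⇒< a b))

≤ᵇ-true : {a b : ℕ} → a ≤ℕ b → (a ≤ᵇ b) ≡ true
≤ᵇ-true = to T-≡ ∘ ≤⇒≤ᵇ

≤ᵇ-false : {a b : ℕ} → b <ℕ a → (a ≤ᵇ b) ≡ false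
≤ᵇ-false {a} {b} b<a = to T-not-≡ (from T-not (<⇒≱ b<a ∘ ≤ᵇ⇒≤ a b))

count : (A → Bool) → List A → ℕ
count p xs = length (filterᵇ p xs)

count-++ : (p : A → Bool) (xs ys : List A) → count p (xs ++ ys) ≡ count p xs + count p ys
count-++ p []       ys = refl
count-++ p (x ∷ xs) ys with p x
... | true  = cong suc (count-++ p xs ys)
... | false = count-++ p xs ys

count-map : {B : Set} (p : B → Bool) (f : A → B) (xs : List A) → count p (map f xs) ≡ count (p ∘ f) xs
count-map p f []       = refl
count-map p f (x ∷ xs) with p (f x)
... | true  = cong suc (count-map p f xs)
... | false = count-map p f xs

count-cong : {p q : A → Bool} (xs : List A) → (∀ {x} → x ∈ xs → p x ≡ q x) → count p xs ≡ count q xs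
count-cong []       _  = refl
count-cong {q = q} (x ∷ xs) eq rewrite eq (here refl) with q x
... | true  = cong suc (count-cong xs (eq ∘ there))
... | false = count-cong xs (eq ∘ there)

count-concatMap : {B : Set} (p : B → Bool) (f : A → List B) (xs : List A) →
                  count p (concatMap f xs) ≡ sum (map (count p ∘ f) xs)
count-concatMap p f []       = refl
count-concatMap p f (x ∷ xs) =
  trans (count-++ p (f x) (concatMap f xs)) (cong (count p (f x) +_) (count-concatMap p f xs))

module _ (f : A → A) (f-involutive : ∀ x → f (f x) ≡ x)
         {xs : List A} (unique : Unique xs) (closed : ∀ {x} → x ∈ xs → f x ∈ xs) where

  map-involution-↭ : map f xs ↭ xs
  map-involution-↭ =
    ∼bag⇒↭ (unique∧set⇒bag (Unique.map⁺ f-injective unique) unique (mk⇔ ∈-map⇒∈ ∈⇒∈-map))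
    where
    f-injective : ∀ {x y} → f x ≡ f y → x ≡ y
    f-injective {x} {y} eq = trans (sym (f-involutive x)) (trans (cong f eq) (f-involutive y))
    ∈-map⇒∈ : ∀ {x} → x ∈ map f xs → x ∈ xs
    ∈-map⇒∈ x∈ with ∈-map⁻ f x∈
    ... | y , y∈ , refl = closed y∈
    ∈⇒∈-map : ∀ {x} → x ∈ xs → x ∈ map f xs
    ∈⇒∈-map {x} x∈ = subst (_∈ map f xs) (f-involutive x) (∈-map⁺ f (closed x∈))

  count-involution : (p : A → Bool) → count (p ∘ f) xs ≡ count p xs
  count-involution p = trans (sym (count-map p f xs)) (↭.↭-length (↭.filter-↭ (T? ∘ p) map-involution-↭))

∑ : (Fin n → ℕ) → ℕ
∑ f = sum (map f (allFin _))

∑-cong : {f g : Fin n → ℕ} → (∀ i → f i ≡ g i) → ∑ f ≡ ∑ g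
∑-cong eq = cong sum (map-cong eq (allFin _))

concatMap≡cartesianProductWith : {B C : Set} (f : A → B → C) (xs : List A) (ys : List B) →
                                 concatMap (λ x → map (f x) ys) xs ≡ cartesianProductWith f xs ys
concatMap≡cartesianProductWith f []       ys = refl
concatMap≡cartesianProductWith f (x ∷ xs) ys = cong (map (f x) ys ++_) (concatMap≡cartesianProductWith f xs ys)

∈-vecs : (v : Vec (Fin n) k) → v ∈ vecs k n
∈-vecs []              = here refl
∈-vecs {n} {suc k} (x ∷ v) =
  subst ((x ∷ v) ∈_) (sym (concatMap≡cartesianProductWith _∷_ (allFin n) (vecs k n)))
        (∈-cartesianProductWith⁺ _∷_ (∈-allFin x) (∈-vecs v))

vecs-unique : ∀ k n → Unique (vecs k n)
vecs-unique zero    n = All.[] AllPairs.∷ AllPairs.[]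
vecs-unique (suc k) n =
  subst Unique (sym (concatMap≡cartesianProductWith _∷_ (allFin n) (vecs k n)))
        (Unique.cartesianProductWith⁺ _∷_ ∷-injective (Unique.allFin⁺ n) (vecs-unique k n))

count-vecs-suc : (p : Vec (Fin n) (suc k) → Bool) → count p (vecs (suc k) n) ≡ ∑ λ x → count (p ∘ (x ∷_)) (vecs k n)
count-vecs-suc {n} {k} p =
  trans (count-concatMap p (λ x → map (x ∷_) (vecs k n)) (allFin n)) (∑-cong λ x → count-map p (x ∷_) (vecs k n))

count-vecs₃ : (p : Vec (Fin n) 3 → Bool) →
              count p (vecs 3 n) ≡ ∑ λ x → ∑ λ y → count (λ z → p (x ∷ y ∷ z ∷ [])) (allFin n)
count-vecs₃ {n} p = trans (count-vecs-suc p) (∑-cong λ x → trans (count-vecs-suc (p ∘ (x ∷_))) (∑-cong λ y →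
                      let q = p ∘ (x ∷_) ∘ (y ∷_) in trans (cong (count q) vecs₁) (count-map q (_∷ []) (allFin n))))
  where
  vecs₁ : vecs 1 n ≡ map (_∷ []) (allFin n)
  vecs₁ = trans (sym (concatMap-map [_] (_∷ []) (allFin n))) (concatMap-pure _)

IsPermutation : Vec (Fin n) n → Set
IsPermutation π = Injective _≡_ _≡_ (lookup π)

T-isPerm : {π : Vec (Fin n) n} → T (isPerm π) ⇔ IsPermutation π
T-isPerm {n} {π} = mk⇔
  (λ t {i} {j} → to distinct (to (T-allᵇ-allFin² {p = entry}) t i j))
  (λ inj → from (T-allᵇ-allFin² {p = entry}) λ i j → from distinct inj)
  where
  entry : Fin n → Fin n → Bool
  entry i j = (toℕ i ≡ᵇ toℕ j) ∨' not (toℕ (lookup π i) ≡ᵇ toℕ (lookup π j))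
  distinct : ∀ {i j} → T (entry i j) ⇔ (lookup π i ≡ lookup π j → i ≡ j)
  distinct = mk⇔ (λ t eq → toℕ-injective (≡ᵇ⇒≡ _ _ (to T-∨'-not t (≡⇒≡ᵇ _ _ (cong toℕ eq)))))
                 (λ f → from T-∨'-not (λ t → ≡⇒≡ᵇ _ _ (cong toℕ (f (toℕ-injective (≡ᵇ⇒≡ _ _ t))))))

∈-Perms⇔ : {π : Vec (Fin n) n} → π ∈ Perms n ⇔ IsPermutation π
∈-Perms⇔ {n} {π} = mk⇔
  (to (T-isPerm {π = π}) ∘ proj₂ ∘ ∈-filter⁻ (T? ∘ isPerm) {xs = vecs n n})
  (∈-filter⁺ (T? ∘ isPerm) (∈-vecs π) ∘ from (T-isPerm {π = π}))

Perms-unique : ∀ n → Unique (Perms n)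
Perms-unique n = Unique.filter⁺ (T? ∘ isPerm) (vecs-unique n n)

module _ (i j : Fin n) where

  transpose-matchˡ : transpose i j i ≡ j
  transpose-matchˡ with i ≟ i
  ... | yes _   = refl
  ... | no i≢i = ⊥-elim (i≢i refl)

  transpose-matchʳ : transpose i j j ≡ i
  transpose-matchʳ with j ≟ i
  ... | yes j≡i = j≡i
  ... | no _ with j ≟ j
  ...   | yes _   = refl
  ...   | no j≢j = ⊥-elim (j≢j refl)

  transpose-mismatch : ∀ {k} → k ≢ i → k ≢ j → transpose i j k ≡ k
  transpose-mismatch {k} k≢i k≢j with k ≟ i
  ... | yes k≡i = ⊥-elim (k≢i k≡i)
  ... | no _ with k ≟ j
  ...   | yes k≡j = ⊥-elim (k≢j k≡j)
  ...   | no _    = refl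

  transpose-involutive : ∀ k → transpose i j (transpose i j k) ≡ k
  transpose-involutive k with k ≟ i
  ... | yes refl = transpose-matchʳ
  ... | no k≢i with k ≟ j
  ...   | yes refl = transpose-matchˡ
  ...   | no k≢j   = transpose-mismatch k≢i k≢j

  transpose-injective : Injective _≡_ _≡_ (transpose i j)
  transpose-injective {k} {l} eq =
    trans (sym (transpose-involutive k)) (trans (cong (transpose i j) eq) (transpose-involutive l))

  transpose-closed : {P : Fin n → Set} → P i → P j → ∀ {k} → P k → P (transpose i j k)
  transpose-closed Pi Pj {k} Pk with k ≟ i
  ... | yes _ = Pj
  ... | no _ with k ≟ j
  ...   | yes _ = Pi
  ...   | no _  = Pk

swap : Vec (Fin n) n → Fin n → Fin n → Vec (Fin n) n
swap π m k = tabulate (lookup π ∘ transpose m k)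

module _ (π : Vec (Fin n) n) (m k : Fin n) where

  lookup-swap : ∀ i → lookup (swap π m k) i ≡ lookup π (transpose m k i)
  lookup-swap = lookup∘tabulate _

  swap-involutive : swap (swap π m k) m k ≡ π
  swap-involutive = trans (tabulate-cong λ i → trans (lookup-swap (transpose m k i))
                                                     (cong (lookup π) (transpose-involutive m k i)))
                          (tabulate∘lookup π)

  swap-isPermutation : IsPermutation π → IsPermutation (swap π m k)
  swap-isPermutation inj eq = transpose-injective m k (inj (trans (sym (lookup-swap _)) (trans eq (lookup-swap _))))

module _ {n : ℕ} (π : Vec (Fin n) n) where

  inBoxᵇ : List ℕ → List ℕ → ℕ × ℕ → Fin n → Bool
  inBoxᵇ I V (a , b) m =
    (nth I a <ᵇ pos m) ∧ ((pos m <ᵇ nth I (suc a)) ∧ ((nth V b <ᵇ val π m) ∧ (val π m <ᵇ nth V (suc b))))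

  boxEmptyᵇ : List ℕ → List ℕ → ℕ × ℕ → Bool
  boxEmptyᵇ I V ab = not (anyᵇ (inBoxᵇ I V ab) (allFin n))

  InBox : List ℕ → List ℕ → ℕ × ℕ → Fin n → Set
  InBox I V (a , b) m = nth I a <ℕ pos m × pos m <ℕ nth I (suc a) × nth V b <ℕ val π m × val π m <ℕ nth V (suc b)

  BoxEmpty : List ℕ → List ℕ → ℕ × ℕ → Set
  BoxEmpty I V ab = ∀ m → ¬ InBox I V ab m

  T-inBox : ∀ I V ab m → T (inBoxᵇ I V ab m) ⇔ InBox I V ab m
  T-inBox _ _ _ _ = mk⇔
    (λ t → let p , t = to T-∧ t; q , t = to T-∧ t; r , s = to T-∧ t in
           to T-<ᵇ p , to T-<ᵇ q , to T-<ᵇ r , to T-<ᵇ s)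
    (λ (p , q , r , s) → from T-∧ (from T-<ᵇ p , from T-∧ (from T-<ᵇ q , from T-∧ (from T-<ᵇ r , from T-<ᵇ s))))

  T-boxEmpty : ∀ I V ab → T (boxEmptyᵇ I V ab) ⇔ BoxEmpty I V ab
  T-boxEmpty I V ab rewrite not-anyᵇ (inBoxᵇ I V ab) (allFin n) = mk⇔
    (λ t m → to T-not (to T-allᵇ-allFin t m) ∘ from (T-inBox I V ab m))
    (λ e → from T-allᵇ-allFin (λ m → from T-not (e m ∘ to (T-inBox I V ab m))))

  positions values : Vec (Fin n) k → List ℕ
  positions is = 0 ∷ map pos (toList is) ++ [ suc n ]
  values    is = 0 ∷ sort (map (val π) (toList is)) ++ [ suc n ]

increasingᵇ : Vec (Fin n) k → Bool
increasingᵇ {k = k} is =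
  allᵇ (λ a → allᵇ (λ b → not (toℕ a <ᵇ toℕ b) ∨' (toℕ (lookup is a) <ᵇ toℕ (lookup is b))) (allFin k)) (allFin k)

Increasing : Vec (Fin n) k → Set
Increasing {k = k} is = ∀ (a b : Fin k) → a < b → lookup is a < lookup is b

T-increasing : (is : Vec (Fin n) k) → T (increasingᵇ is) ⇔ Increasing is
T-increasing _ = mk⇔
  (λ t a b a<b → to T-<ᵇ (to T-not-∨' (to T-allᵇ-allFin² t a b) (from T-<ᵇ a<b)))
  (λ inc → from T-allᵇ-allFin² λ a b → from T-not-∨' (from T-<ᵇ ∘ inc a b ∘ to T-<ᵇ))

orderIsoᵇ : (Fin k → ℕ) → Vec (Fin k) k → Bool
orderIsoᵇ {k} v τ =
  allᵇ (λ a → allᵇ (λ b → (v a <ᵇ v b) ⇔ᵇ (toℕ (lookup τ a) <ᵇ toℕ (lookup τ b))) (allFin k)) (allFin k)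

OrderIsomorphic : (Fin k → ℕ) → Vec (Fin k) k → Set
OrderIsomorphic v τ = ∀ a b → (v a <ℕ v b) ⇔ (lookup τ a < lookup τ b)

T-orderIso : (v : Fin k → ℕ) (τ : Vec (Fin k) k) → T (orderIsoᵇ v τ) ⇔ OrderIsomorphic v τ
T-orderIso _ _ = mk⇔
  (λ t a b → let e = to T-⇔ᵇ (to T-allᵇ-allFin² t a b) in
     mk⇔ (to T-<ᵇ ∘ to e ∘ from T-<ᵇ) (to T-<ᵇ ∘ from e ∘ from T-<ᵇ))
  (λ iso → from T-allᵇ-allFin² λ a b →
     from T-⇔ᵇ (mk⇔ (from T-<ᵇ ∘ to (iso a b) ∘ to T-<ᵇ) (from T-<ᵇ ∘ from (iso a b) ∘ to T-<ᵇ)))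

-- isOcc unfolds definitionally to increasingᵇ ∧ (orderIsoᵇ ∧ allᵇ boxEmptyᵇ), the Boolean tests above.
T-isOcc : (τ : Vec (Fin k) k) (R : List (ℕ × ℕ)) (π : Vec (Fin n) n) (is : Vec (Fin n) k) →
          T (isOcc (mesh k τ R) π is) ⇔
          (Increasing is × OrderIsomorphic (val π ∘ lookup is) τ × All (BoxEmpty π (positions π is) (values π is)) R)
T-isOcc {k = k} τ R π is = mk⇔
  (λ t → let i , t = to T-∧ t; o , s = to T-∧ t in to (T-increasing is) i , to (T-orderIso v τ) o , to shading s)
  (λ (i , o , s) → from T-∧ (from (T-increasing is) i , from T-∧ (from (T-orderIso v τ) o , from shading s)))
  where
  v : Fin k → ℕ
  v = val π ∘ lookup is
  I V : List ℕ
  I = positions π is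
  V = values π is
  shading : T (allᵇ (boxEmptyᵇ π I V) R) ⇔ All (BoxEmpty π I V) R
  shading = mk⇔ (All.map (to (T-boxEmpty π I V _)) ∘ to (T-allᵇ R))
                (from (T-allᵇ R) ∘ All.map (from (T-boxEmpty π I V _)))

strictMono-reflects : {f : Fin k → ℕ} → (∀ {a b} → a < b → f a <ℕ f b) → ∀ {a b} → f a <ℕ f b → a < b
strictMono-reflects mono {a} {b} fa<fb with <-cmp a b
... | tri< a<b _ _  = a<b
... | tri≈ _ refl _ = ⊥-elim (<-irrefl refl fa<fb)
... | tri> _ _ b<a  = ⊥-elim (<-asym fa<fb (mono b<a))

strictMono₃ : {f : Fin 3 → ℕ} → f 0F <ℕ f 1F → f 1F <ℕ f 2F → ∀ {a b} → a < b → f a <ℕ f b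
strictMono₃ p q {0F} {1F} _ = p
strictMono₃ p q {0F} {2F} _ = <-trans p q
strictMono₃ p q {1F} {2F} _ = q
strictMono₃ p q {0F} {0F} ()
strictMono₃ p q {1F} {0F} ()
strictMono₃ p q {1F} {1F} (s<s ())
strictMono₃ p q {2F} {0F} ()
strictMono₃ p q {2F} {1F} (s<s ())
strictMono₃ p q {2F} {2F} (s<s (s<s ()))

orderIsomorphic-∘ : {g : Fin k → ℕ} {τ : Vec (Fin k) k} → (∀ {a b} → a < b → g a <ℕ g b) →
                    OrderIsomorphic (g ∘ lookup τ) τ
orderIsomorphic-∘ mono a b = mk⇔ (strictMono-reflects mono) mono

OrderIsomorphic-cong : {v w : Fin k → ℕ} {τ : Vec (Fin k) k} → (∀ a → v a ≡ w a) →
                       OrderIsomorphic v τ → OrderIsomorphic w τ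
OrderIsomorphic-cong v≗w iso a b = subst₂ (λ p q → (p <ℕ q) ⇔ _) (v≗w a) (v≗w b) (iso a b)

orderIsomorphic-123 : {f : Fin 3 → ℕ} → OrderIsomorphic f τ123 ⇔ (f 0F <ℕ f 1F × f 1F <ℕ f 2F)
orderIsomorphic-123 {f} = mk⇔
  (λ iso → from (iso 0F 1F) z<s , from (iso 1F 2F) (s<s z<s))
  (λ (p , q) → OrderIsomorphic-cong {τ = τ123} (λ { 0F → refl ; 1F → refl ; 2F → refl })
                                    (orderIsomorphic-∘ {g = f} {τ = τ123} (strictMono₃ p q)))

orderIsomorphic-132 : {f : Fin 3 → ℕ} → OrderIsomorphic f τ132 ⇔ (f 0F <ℕ f 2F × f 2F <ℕ f 1F)
orderIsomorphic-132 {f} = mk⇔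
  (λ iso → from (iso 0F 2F) z<s , from (iso 2F 1F) (s<s z<s))
  (λ (p , q) → OrderIsomorphic-cong {τ = τ132} (λ { 0F → refl ; 1F → refl ; 2F → refl })
                                    (orderIsomorphic-∘ {g = f ∘ lookup τ132} {τ = τ132} (strictMono₃ p q)))

increasing₃ : {x y z : Fin n} → Increasing (x ∷ y ∷ z ∷ []) ⇔ (x < y × y < z)
increasing₃ {x = x} {y} {z} = mk⇔
  (λ inc → inc 0F 1F z<s , inc 1F 2F (s<s z<s))
  (λ (x<y , y<z) a b → strictMono₃ {f = toℕ ∘ lookup (x ∷ y ∷ z ∷ [])} x<y y<z)

sort-123 : {a b c : ℕ} → a <ℕ b → b <ℕ c → sort (a ∷ b ∷ c ∷ []) ≡ a ∷ b ∷ c ∷ []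
sort-123 a<b b<c rewrite ≤ᵇ-true (<⇒≤ a<b) | ≤ᵇ-true (<⇒≤ (<-trans a<b b<c)) | ≤ᵇ-true (<⇒≤ b<c) = refl

sort-132 : {a b c : ℕ} → a <ℕ c → c <ℕ b → sort (a ∷ b ∷ c ∷ []) ≡ a ∷ c ∷ b ∷ []
sort-132 a<c c<b rewrite ≤ᵇ-true (<⇒≤ (<-trans a<c c<b)) | ≤ᵇ-true (<⇒≤ a<c) | ≤ᵇ-false c<b = refl

LowBox : ℕ × ℕ → Set
LowBox (a , b) = a ≤ℕ 1 × b ≤ℕ 1

LowShaded : List (ℕ × ℕ) → Vec (Fin n) n → (x y u v : Fin n) → Set
LowShaded R π x y u v = All (BoxEmpty π (0 ∷ pos x ∷ pos y ∷ []) (0 ∷ suc (toℕ u) ∷ suc (toℕ v) ∷ [])) R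

lowBox-truncate : {π : Vec (Fin n) n} {i j u v : ℕ} {I V : List ℕ} {ab : ℕ × ℕ} → LowBox ab →
                  BoxEmpty π (0 ∷ i ∷ j ∷ I) (0 ∷ u ∷ v ∷ V) ab ⇔
                  BoxEmpty π (0 ∷ i ∷ j ∷ []) (0 ∷ u ∷ v ∷ []) ab
lowBox-truncate (z≤n     , z≤n)     = mk⇔ id id
lowBox-truncate (z≤n     , s≤s z≤n) = mk⇔ id id
lowBox-truncate (s≤s z≤n , z≤n)     = mk⇔ id id
lowBox-truncate (s≤s z≤n , s≤s z≤n) = mk⇔ id id

-- The positions x < y < z of an occurrence of 123 or 132, with mid and top the positions of its
-- middle and largest value. below-mid is what the four boxes of C say, and low-empty what
-- the boxes of R say when R ⊆ {0,1}².
record Occurrence (R : List (ℕ × ℕ)) (π : Vec (Fin n) n) (x y z mid top : Fin n) : Set where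
  field
    x<y       : x < y
    y<z       : y < z
    x<mid     : lookup π x < lookup π mid
    mid<top   : lookup π mid < lookup π top
    below-mid : ∀ l → y < l → l ≢ z → lookup π l < lookup π mid
    low-empty : LowShaded R π x y (lookup π x) (lookup π mid)

Occurrence₁₂₃ Occurrence₁₃₂ : List (ℕ × ℕ) → Vec (Fin n) n → (x y z : Fin n) → Set
Occurrence₁₂₃ R π x y z = Occurrence R π x y z y z
Occurrence₁₃₂ R π x y z = Occurrence R π x y z z y

≢-ends : {y z mid top l : Fin n} → (mid ≡ y × top ≡ z) ⊎ (mid ≡ z × top ≡ y) →
         y < l → l ≢ z → l ≢ mid × l ≢ top
≢-ends (inj₁ (refl , refl)) y<l l≢z = ≢-sym (<⇒≢ y<l) , l≢z
≢-ends (inj₂ (refl , refl)) y<l l≢z = l≢z , ≢-sym (<⇒≢ y<l)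

module Shading (π : Vec (Fin n) n) (inj : IsPermutation π) {x y z mid top : Fin n}
               (ends : (mid ≡ y × top ≡ z) ⊎ (mid ≡ z × top ≡ y))
               (y<z : y < z) (mid<top : lookup π mid < lookup π top) where

  I V : List ℕ
  I = 0 ∷ pos x ∷ pos y ∷ pos z ∷ suc n ∷ []
  V = 0 ∷ val π x ∷ val π mid ∷ val π top ∷ suc n ∷ []

  C-empty⇔ : All (BoxEmpty π I V) C ⇔ (∀ l → y < l → l ≢ z → lookup π l < lookup π mid)
  C-empty⇔ = mk⇔ below-mid empty
    where
    below-mid : All (BoxEmpty π I V) C → ∀ l → y < l → l ≢ z → lookup π l < lookup π mid
    below-mid (e₂₂ ∷ e₂₃ ∷ e₃₂ ∷ e₃₃ ∷ []) l y<l l≢z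
      with <-cmp (lookup π l) (lookup π mid) | <-cmp l z | <-cmp (lookup π l) (lookup π top)
    ... | tri< l<mid _ _ | _            | _              = l<mid
    ... | tri≈ _ eq _    | _            | _              = ⊥-elim (proj₁ (≢-ends ends y<l l≢z) (inj eq))
    ... | tri> _ _ _     | tri≈ _ eq _  | _              = ⊥-elim (l≢z eq)
    ... | tri> _ _ _     | _            | tri≈ _ eq _    = ⊥-elim (proj₂ (≢-ends ends y<l l≢z) (inj eq))
    ... | tri> _ _ mid<l | tri< l<z _ _ | tri< l<top _ _ = ⊥-elim (e₂₂ l (s<s y<l , s<s l<z , s<s mid<l , s<s l<top))
    ... | tri> _ _ _     | tri< l<z _ _ | tri> _ _ top<l = ⊥-elim (e₂₃ l (s<s y<l , s<s l<z , s<s top<l , s<s (toℕ<n _)))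
    ... | tri> _ _ mid<l | tri> _ _ z<l | tri< l<top _ _ = ⊥-elim (e₃₂ l (s<s z<l , s<s (toℕ<n l) , s<s mid<l , s<s l<top))
    ... | tri> _ _ _     | tri> _ _ z<l | tri> _ _ top<l = ⊥-elim (e₃₃ l (s<s z<l , s<s (toℕ<n l) , s<s top<l , s<s (toℕ<n _)))
    empty : (∀ l → y < l → l ≢ z → lookup π l < lookup π mid) → All (BoxEmpty π I V) C
    empty below = e₂₂ ∷ e₂₃ ∷ e₃₂ ∷ e₃₃ ∷ []
      where
      right-of-z : ∀ {l} → z < l → lookup π l < lookup π mid
      right-of-z z<l = below _ (<-trans y<z z<l) (≢-sym (<⇒≢ z<l))
      e₂₂ : BoxEmpty π I V (2 , 2)
      e₂₂ l (y<l , l<z , mid<l , _) = <-asym (s<s⁻¹ mid<l) (below l (s<s⁻¹ y<l) (<⇒≢ (s<s⁻¹ l<z)))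
      e₂₃ : BoxEmpty π I V (2 , 3)
      e₂₃ l (y<l , l<z , top<l , _) = <-asym (<-trans mid<top (s<s⁻¹ top<l)) (below l (s<s⁻¹ y<l) (<⇒≢ (s<s⁻¹ l<z)))
      e₃₂ : BoxEmpty π I V (3 , 2)
      e₃₂ l (z<l , _ , mid<l , _) = <-asym (s<s⁻¹ mid<l) (right-of-z (s<s⁻¹ z<l))
      e₃₃ : BoxEmpty π I V (3 , 3)
      e₃₃ l (z<l , _ , top<l , _) = <-asym (<-trans mid<top (s<s⁻¹ top<l)) (right-of-z (s<s⁻¹ z<l))

  shading⇔ : {R : List (ℕ × ℕ)} → All LowBox R →
             All (BoxEmpty π I V) (C ++ R) ⇔
             ((∀ l → y < l → l ≢ z → lookup π l < lookup π mid) × LowShaded R π x y (lookup π x) (lookup π mid))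
  shading⇔ low = mk⇔
    (λ e → let eC , eR = Allₚ.++⁻ C e in
           to C-empty⇔ eC , All.zipWith (λ (l , e) → to (lowBox-truncate {π = π} l) e) (low , eR))
    (λ (below , eR) →
           Allₚ.++⁺ (from C-empty⇔ below) (All.zipWith (λ (l , e) → from (lowBox-truncate {π = π} l) e) (low , eR)))

module _ {R : List (ℕ × ℕ)} (low : All LowBox R) (π : Vec (Fin n) n) (inj : IsPermutation π) {x y z : Fin n} where

  isOcc⇔ : {τ : Vec (Fin 3) 3} {mid top : Fin n} → (mid ≡ y × top ≡ z) ⊎ (mid ≡ z × top ≡ y) →
           OrderIsomorphic (val π ∘ lookup (x ∷ y ∷ z ∷ [])) τ ⇔ (val π x <ℕ val π mid × val π mid <ℕ val π top) →
           (val π x <ℕ val π mid → val π mid <ℕ val π top →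
            sort (val π x ∷ val π y ∷ val π z ∷ []) ≡ val π x ∷ val π mid ∷ val π top ∷ []) →
           T (isOcc (mesh 3 τ (C ++ R)) π (x ∷ y ∷ z ∷ [])) ⇔ Occurrence R π x y z mid top
  isOcc⇔ {τ} ends iso⇔ sorted = mk⇔
    (λ t → let inc , iso , e = to (T-isOcc τ (C ++ R) π (x ∷ y ∷ z ∷ [])) t
               x<y , y<z = to increasing₃ inc
               x<mid , mid<top = to iso⇔ iso
               below , low-e = to (Shading.shading⇔ π inj ends y<z (s<s⁻¹ mid<top) low)
                                  (subst Shaded (sorted x<mid mid<top) e)
           in record { x<y = x<y ; y<z = y<z ; x<mid = s<s⁻¹ x<mid ; mid<top = s<s⁻¹ mid<top
                     ; below-mid = below ; low-empty = low-e })
    (λ o → let open Occurrence o in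
           from (T-isOcc τ (C ++ R) π (x ∷ y ∷ z ∷ []))
                ( from increasing₃ (x<y , y<z)
                , from iso⇔ (s<s x<mid , s<s mid<top)
                , subst Shaded (sym (sorted (s<s x<mid) (s<s mid<top)))
                        (from (Shading.shading⇔ π inj ends y<z mid<top low) (below-mid , low-empty))))
    where
    Shaded : List ℕ → Set
    Shaded S = All (BoxEmpty π (positions π (x ∷ y ∷ z ∷ [])) (0 ∷ S ++ [ suc n ])) (C ++ R)

  isOcc₁₂₃⇔ : T (isOcc (mesh 3 τ123 (C ++ R)) π (x ∷ y ∷ z ∷ [])) ⇔ Occurrence₁₂₃ R π x y z
  isOcc₁₂₃⇔ = isOcc⇔ {τ = τ123} (inj₁ (refl , refl)) orderIsomorphic-123 sort-123

  isOcc₁₃₂⇔ : T (isOcc (mesh 3 τ132 (C ++ R)) π (x ∷ y ∷ z ∷ [])) ⇔ Occurrence₁₃₂ R π x y z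
  isOcc₁₃₂⇔ = isOcc⇔ {τ = τ132} (inj₂ (refl , refl)) orderIsomorphic-132 sort-132

AgreeBelow : Vec (Fin n) n → Vec (Fin n) n → Fin n → Fin n → Set
AgreeBelow π π' y v = ∀ l → l < y → lookup π l ≡ lookup π' l ⊎ (v < lookup π l × v < lookup π' l)

nth-bound : {a i j : ℕ} → a ≤ℕ 1 → i ≤ℕ j → nth (0 ∷ i ∷ j ∷ []) (suc a) ≤ℕ j
nth-bound z≤n       i≤j = i≤j
nth-bound (s≤s z≤n) _   = ≤-refl

InBox-cong : {π π' : Vec (Fin n) n} {I V : List ℕ} {ab : ℕ × ℕ} {l : Fin n} →
             lookup π l ≡ lookup π' l → InBox π I V ab l → InBox π' I V ab l
InBox-cong eq (p , q , r , s) rewrite eq = p , q , r , s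

lowShaded-transfer : {R : List (ℕ × ℕ)} {π π' : Vec (Fin n) n} {x y u v : Fin n} →
                     All LowBox R → x ≤ y → u ≤ v → AgreeBelow π π' y v →
                     LowShaded R π x y u v → LowShaded R π' x y u v
lowShaded-transfer {π = π} {π'} {x} {y} {u} {v} low x≤y u≤v agree shaded = All.zipWith transfer (low , shaded)
  where
  I V : List ℕ
  I = 0 ∷ pos x ∷ pos y ∷ []
  V = 0 ∷ suc (toℕ u) ∷ suc (toℕ v) ∷ []
  transfer : ∀ {ab} → LowBox ab × BoxEmpty π I V ab → BoxEmpty π' I V ab
  transfer {ab} ((a≤1 , b≤1) , empty) l inBox@(_ , l<x , _ , πl<v)
    with agree l (s<s⁻¹ (<-≤-trans l<x (nth-bound a≤1 (s≤s x≤y))))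
  ... | inj₁ eq         = empty l (InBox-cong {π = π'} {π} {I} {V} {ab} (sym eq) inBox)
  ... | inj₂ (_ , v<πl) = <-asym v<πl (s<s⁻¹ (<-≤-trans πl<v (nth-bound b≤1 (s≤s u≤v))))

Partner : Vec (Fin n) n → Fin n → Fin n → Set
Partner π m k = m < k × (∀ l → m < l → l ≢ k → lookup π l < lookup π m × lookup π l < lookup π k)

Partner-unique : {π : Vec (Fin n) n} {m k k' : Fin n} → Partner π m k → Partner π m k' → k ≡ k'
Partner-unique {k = k} {k'} (m<k , below) (m<k' , below') with k ≟ k'
... | yes k≡k' = k≡k'
... | no k≢k'  = ⊥-elim (<-asym (proj₂ (below k' m<k' (≢-sym k≢k'))) (proj₂ (below' k m<k k≢k')))

module _ {R : List (ℕ × ℕ)} {π : Vec (Fin n) n} {x y z : Fin n} where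

  occurrence₁₂₃⇒Partner : Occurrence₁₂₃ R π x y z → Partner π y z
  occurrence₁₂₃⇒Partner o = y<z , λ l y<l l≢z → below-mid l y<l l≢z , <-trans (below-mid l y<l l≢z) mid<top
    where open Occurrence o

  occurrence₁₃₂⇒Partner : Occurrence₁₃₂ R π x y z → Partner π y z
  occurrence₁₃₂⇒Partner o = y<z , λ l y<l l≢z → <-trans (below-mid l y<l l≢z) mid<top , below-mid l y<l l≢z
    where open Occurrence o

module Swapped (π π' : Vec (Fin n) n) {m k : Fin n} (partner : Partner π m k)
               (π'≗π∘τ : ∀ i → lookup π' i ≡ lookup π (transpose m k i)) where

  m<k : m < k
  m<k = proj₁ partner

  π'-m : lookup π' m ≡ lookup π k
  π'-m = trans (π'≗π∘τ m) (cong (lookup π) (transpose-matchˡ m k))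

  π'-k : lookup π' k ≡ lookup π m
  π'-k = trans (π'≗π∘τ k) (cong (lookup π) (transpose-matchʳ m k))

  π'-other : ∀ {i} → i ≢ m → i ≢ k → lookup π' i ≡ lookup π i
  π'-other i≢m i≢k = trans (π'≗π∘τ _) (cong (lookup π) (transpose-mismatch m k i≢m i≢k))

  π'-left : ∀ {i} → i < m → lookup π' i ≡ lookup π i
  π'-left i<m = π'-other (<⇒≢ i<m) (<⇒≢ (<-trans i<m m<k))

  Partner-π' : Partner π' m k
  Partner-π' = m<k , λ l m<l l≢k → let π'l≡πl = π'-other (≢-sym (<⇒≢ m<l)) l≢k
                                       l<m , l<k = proj₂ partner l m<l l≢k in
    subst₂ _<_ (sym π'l≡πl) (sym π'-m) l<k , subst₂ _<_ (sym π'l≡πl) (sym π'-k) l<m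

  agree-left : ∀ {y v} → y ≤ m → AgreeBelow π π' y v
  agree-left y≤m l l<y = inj₁ (sym (π'-left (<-≤-trans l<y y≤m)))

  agree-above : ∀ {y v} → v < lookup π m → v < lookup π k → AgreeBelow π π' y v
  agree-above {v = v} v<m v<k l _ with l ≟ m | l ≟ k
  ... | yes refl | _        = inj₂ (v<m , subst (v <_) (sym π'-m) v<k)
  ... | no _     | yes refl = inj₂ (v<k , subst (v <_) (sym π'-k) v<m)
  ... | no l≢m   | no l≢k   = inj₁ (sym (π'-other l≢m l≢k))

  module _ {R : List (ℕ × ℕ)} (low : All LowBox R) where

    transfer-left : ∀ {x y z} → y < m → Occurrence₁₂₃ R π x y z → Occurrence₁₂₃ R π' x y (transpose m k z)
    transfer-left {x} {y} {z} y<m o = record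
      { x<y       = x<y
      ; y<z       = transpose-closed m k {P = y <_} y<m (<-trans y<m m<k) y<z
      ; x<mid     = subst₂ _<_ (sym π'x) (sym π'y) x<mid
      ; mid<top   = subst₂ _<_ (sym π'y) (sym π'z) mid<top
      ; below-mid = λ l y<l l≢τz → subst₂ _<_ (sym (π'≗π∘τ l)) (sym π'y)
                      (below-mid (transpose m k l) (transpose-closed m k {P = y <_} y<m (<-trans y<m m<k) y<l)
                                 (λ τl≡z → l≢τz (trans (sym (transpose-involutive m k l)) (cong (transpose m k) τl≡z))))
      ; low-empty = subst₂ (LowShaded R π' x y) (sym π'x) (sym π'y)
                      (lowShaded-transfer {π = π} {π'} low (<⇒≤ x<y) (<⇒≤ x<mid) (agree-left (<⇒≤ y<m)) low-empty)
      }
      where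
      open Occurrence o
      π'x : lookup π' x ≡ lookup π x
      π'x = π'-left (<-trans x<y y<m)
      π'y : lookup π' y ≡ lookup π y
      π'y = π'-left y<m
      π'z : lookup π' (transpose m k z) ≡ lookup π z
      π'z = trans (π'≗π∘τ _) (cong (lookup π) (transpose-involutive m k z))

    transfer-right : ∀ {x y z} → m < y → Occurrence₁₃₂ R π x y z → Occurrence₁₃₂ R π' x y z
    transfer-right {x} {y} {z} m<y o = record
      { x<y       = x<y
      ; y<z       = y<z
      ; x<mid     = subst₂ _<_ (sym π'x) (sym π'z) x<mid
      ; mid<top   = subst (_< lookup π' y) (sym π'z) πz<π'y
      ; below-mid = λ l y<l l≢z → subst₂ _<_ (sym (π'-right y<l)) (sym π'z) (below-mid l y<l l≢z)
      ; low-empty = subst₂ (LowShaded R π' x y) (sym π'x) (sym π'z)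
                      (lowShaded-transfer {π = π} {π'} low (<⇒≤ x<y) (<⇒≤ x<mid)
                                          (agree-above (proj₁ z-below) (proj₂ z-below)) low-empty)
      }
      where
      open Occurrence o
      -- If y < k, then π k and π z would each have to exceed the other.
      k≤y : k ≤ y
      k≤y with <-cmp k y
      ... | tri< k<y _ _  = <⇒≤ k<y
      ... | tri≈ _ refl _ = ≤-refl
      ... | tri> _ _ y<k with z ≟ k
      ...   | yes refl = ⊥-elim (<-asym mid<top (proj₂ (proj₂ partner y m<y (<⇒≢ y<k))))
      ...   | no z≢k   = ⊥-elim (<-asym (below-mid k y<k (≢-sym z≢k)) (proj₂ (proj₂ partner z (<-trans m<y y<z) z≢k)))
      z-below : lookup π z < lookup π m × lookup π z < lookup π k
      z-below = proj₂ partner z (<-trans m<y y<z) (≢-sym (<⇒≢ (≤-<-trans k≤y y<z)))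
      π'-right : ∀ {l} → y < l → lookup π' l ≡ lookup π l
      π'-right y<l = π'-other (≢-sym (<⇒≢ (<-trans m<y y<l))) (≢-sym (<⇒≢ (≤-<-trans k≤y y<l)))
      π'z : lookup π' z ≡ lookup π z
      π'z = π'-right y<z
      π'x : lookup π' x ≡ lookup π x
      π'x = π'-other (λ { refl → <-asym x<mid (proj₁ z-below) }) (λ { refl → <-asym x<mid (proj₂ z-below) })
      πz<π'y : lookup π z < lookup π' y
      πz<π'y with y ≟ k
      ... | yes refl = subst (lookup π z <_) (sym π'-k) (proj₁ z-below)
      ... | no y≢k   = subst (lookup π z <_) (sym (π'-other (≢-sym (<⇒≢ m<y)) y≢k)) mid<top

    transfer-at : ∀ {x mid top mid' top'} → lookup π' mid' ≡ lookup π mid → lookup π' top' ≡ lookup π top →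
                  Occurrence R π x m k mid top → Occurrence R π' x m k mid' top'
    transfer-at {x} π'mid' π'top' o = record
      { x<y       = x<y
      ; y<z       = y<z
      ; x<mid     = subst₂ _<_ (sym π'x) (sym π'mid') x<mid
      ; mid<top   = subst₂ _<_ (sym π'mid') (sym π'top') mid<top
      ; below-mid = λ l m<l l≢k →
                      subst₂ _<_ (sym (π'-other (≢-sym (<⇒≢ m<l)) l≢k)) (sym π'mid') (below-mid l m<l l≢k)
      ; low-empty = subst₂ (LowShaded R π' x m) (sym π'x) (sym π'mid')
                      (lowShaded-transfer {π = π} {π'} low (<⇒≤ x<y) (<⇒≤ x<mid) (agree-left ≤-refl) low-empty)
      }
      where
      open Occurrence o
      π'x : lookup π' x ≡ lookup π x
      π'x = π'-left x<y

Partner? : (π : Vec (Fin n) n) (m k : Fin n) → Dec (Partner π m k)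
Partner? π m k =
  m <? k ×-dec all? λ l → m <? l →-dec ¬? (l ≟ k) →-dec (lookup π l <? lookup π m ×-dec lookup π l <? lookup π k)

Partner-swap : {π : Vec (Fin n) n} {m k : Fin n} → Partner π m k → Partner (swap π m k) m k
Partner-swap {π = π} {m} {k} partner = Swapped.Partner-π' π (swap π m k) partner (lookup-swap π m k)

swapPartner : Fin n → Vec (Fin n) n → Vec (Fin n) n
swapPartner m π with any? (Partner? π m)
... | yes (k , _) = swap π m k
... | no _        = π

swapPartner-involutive : (m : Fin n) (π : Vec (Fin n) n) → swapPartner m (swapPartner m π) ≡ π
swapPartner-involutive m π with any? (Partner? π m)
... | no unpaired with any? (Partner? π m)
...   | yes paired = ⊥-elim (unpaired paired)
...   | no _       = refl
swapPartner-involutive m π | yes (k , partner) with any? (Partner? (swap π m k) m)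
... | no unpaired     = ⊥-elim (unpaired (k , Partner-swap {π = π} partner))
... | yes (k' , partner')
  rewrite Partner-unique {π = swap π m k} partner' (Partner-swap {π = π} partner) = swap-involutive π m k

swapPartner-isPermutation : (m : Fin n) (π : Vec (Fin n) n) → IsPermutation π → IsPermutation (swapPartner m π)
swapPartner-isPermutation m π inj with any? (Partner? π m)
... | yes (k , _) = swap-isPermutation π m k inj
... | no _        = inj

if-<ᵇ-suc : {y m : Fin n} {a a' b b' : ℕ} → (y < m → a' ≡ a) → (y ≡ m → a' ≡ b) → (m < y → b' ≡ b) →
            (if toℕ y <ᵇ suc (toℕ m) then a' else b') ≡ (if toℕ y <ᵇ toℕ m then a else b)
if-<ᵇ-suc {y = y} {m} left at right with <-cmp y m
... | tri< y<m _ _  rewrite <ᵇ-true y<m | <ᵇ-true (m<n⇒m<1+n y<m) = left y<m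
... | tri≈ _ refl _ rewrite <ᵇ-false (<-irrefl {toℕ y} refl) | <ᵇ-true (n<1+n (toℕ y)) = at refl
... | tri> _ _ m<y  rewrite <ᵇ-false (<-asym m<y) | <ᵇ-false (<⇒≱ m<y ∘ s≤s⁻¹) = right m<y

module Hybrid {R : List (ℕ × ℕ)} (low : All LowBox R) where

  P Q : MeshPattern
  P = mesh 3 τ123 (C ++ R)
  Q = mesh 3 τ132 (C ++ R)

  occAt : Vec (Fin 3) 3 → Vec (Fin n) n → Fin n → Fin n → ℕ
  occAt τ π x y = count (λ z → isOcc (mesh 3 τ (C ++ R)) π (x ∷ y ∷ z ∷ [])) (allFin _)

  hybrid : ℕ → Vec (Fin n) n → ℕ
  hybrid j π = ∑ λ x → ∑ λ y → if toℕ y <ᵇ j then occAt τ123 π x y else occAt τ132 π x y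

  hybrid-n : (π : Vec (Fin n) n) → hybrid n π ≡ occ P π
  hybrid-n {n} π =
    trans (∑-cong λ x → ∑-cong λ y → cong (if_then occAt τ123 π x y else occAt τ132 π x y) (<ᵇ-true (toℕ<n y)))
          (sym (count-vecs₃ (isOcc P π)))

  hybrid-0 : (π : Vec (Fin n) n) → hybrid 0 π ≡ occ Q π
  hybrid-0 π = sym (count-vecs₃ (isOcc Q π))

  module _ (π : Vec (Fin n) n) (inj : IsPermutation π) {m x : Fin n} where

    occAt-unpaired : ¬ ∃ (Partner π m) → occAt τ123 π x m ≡ occAt τ132 π x m
    occAt-unpaired unpaired = count-cong (allFin _) λ {z} _ → T-⇔⇒≡ (mk⇔
      (λ t → ⊥-elim (unpaired (z , occurrence₁₂₃⇒Partner (to (isOcc₁₂₃⇔ low π inj) t))))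
      (λ t → ⊥-elim (unpaired (z , occurrence₁₃₂⇒Partner (to (isOcc₁₃₂⇔ low π inj) t)))))

    module _ {k : Fin n} (partner : Partner π m k) where
      private
        π' : Vec (Fin n) n
        π' = swap π m k
        inj' : IsPermutation π'
        inj' = swap-isPermutation π m k inj
        module S  = Swapped π π' partner (lookup-swap π m k)
        module S⁻¹ = Swapped π' π S.Partner-π'
                       (λ i → sym (trans (lookup-swap π m k (transpose m k i))
                                         (cong (lookup π) (transpose-involutive m k i))))

      occAt-left : ∀ {y} → y < m → occAt τ123 π' x y ≡ occAt τ123 π x y
      occAt-left {y} y<m = trans (count-cong (allFin _) λ {z} _ → T-⇔⇒≡ (mk⇔
          (λ t → from (isOcc₁₂₃⇔ low π inj) (S⁻¹.transfer-left low y<m (to (isOcc₁₂₃⇔ low π' inj') t)))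
          (λ t → subst (λ z → T (isOcc P π' (x ∷ y ∷ z ∷ []))) (transpose-involutive m k z)
                   (from (isOcc₁₂₃⇔ low π' inj') (S.transfer-left low y<m (to (isOcc₁₂₃⇔ low π inj) t))))))
        (count-involution (transpose m k) (transpose-involutive m k) (Unique.allFin⁺ _) (λ _ → ∈-allFin _)
                          (λ z → isOcc P π (x ∷ y ∷ z ∷ [])))

      occAt-right : ∀ {y} → m < y → occAt τ132 π' x y ≡ occAt τ132 π x y
      occAt-right {y} m<y = count-cong (allFin _) λ {z} _ → T-⇔⇒≡ (mk⇔
        (from (isOcc₁₃₂⇔ low π inj {x} {y} {z}) ∘ S⁻¹.transfer-right low m<y ∘ to (isOcc₁₃₂⇔ low π' inj'))
        (from (isOcc₁₃₂⇔ low π' inj' {x} {y} {z}) ∘ S.transfer-right low m<y ∘ to (isOcc₁₃₂⇔ low π inj)))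

      occAt-at : occAt τ123 π' x m ≡ occAt τ132 π x m
      occAt-at = count-cong (allFin _) λ {z} _ → T-⇔⇒≡ (mk⇔ (from (isOcc₁₃₂⇔ low π inj {x} {m} {z}) ∘ to₁₃₂)
                                                          (from (isOcc₁₂₃⇔ low π' inj' {x} {m} {z}) ∘ to₁₂₃))
        where
        to₁₃₂ : ∀ {z} → T (isOcc P π' (x ∷ m ∷ z ∷ [])) → Occurrence₁₃₂ R π x m z
        to₁₃₂ t with to (isOcc₁₂₃⇔ low π' inj') t
        ... | o with Partner-unique {π = π'} (occurrence₁₂₃⇒Partner o) S.Partner-π'
        ...   | refl = S⁻¹.transfer-at low S⁻¹.π'-k S⁻¹.π'-m o
        to₁₂₃ : ∀ {z} → T (isOcc Q π (x ∷ m ∷ z ∷ [])) → Occurrence₁₂₃ R π' x m z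
        to₁₂₃ t with to (isOcc₁₃₂⇔ low π inj) t
        ... | o with Partner-unique {π = π} (occurrence₁₃₂⇒Partner o) partner
        ...   | refl = S.transfer-at low S.π'-m S.π'-k o

  hybrid-swapPartner : {π : Vec (Fin n) n} → IsPermutation π → (m : Fin n) →
                       hybrid (suc (toℕ m)) (swapPartner m π) ≡ hybrid (toℕ m) π
  hybrid-swapPartner {π = π} inj m with any? (Partner? π m)
  ... | yes (k , partner) = ∑-cong λ x → ∑-cong λ y → if-<ᵇ-suc {y = y} {m}
          (occAt-left π inj {x = x} partner)
          (λ { refl → occAt-at π inj {x = x} partner })
          (occAt-right π inj {x = x} partner)
  ... | no unpaired = ∑-cong λ x → ∑-cong λ y → if-<ᵇ-suc {y = y} {m}
          (λ _ → refl)
          (λ { refl → occAt-unpaired π inj {x = x} unpaired })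
          (λ _ → refl)

  hybridCount : ℕ → ℕ → ℕ → ℕ
  hybridCount n ℓ j = count (λ π → hybrid j π ≡ᵇ ℓ) (Perms n)

  hybridCount-suc : ∀ {n} ℓ (m : Fin n) → hybridCount n ℓ (suc (toℕ m)) ≡ hybridCount n ℓ (toℕ m)
  hybridCount-suc {n} ℓ m = trans
    (sym (count-involution (swapPartner m) (swapPartner-involutive m) (Perms-unique n)
                           (λ π∈ → from ∈-Perms⇔ (swapPartner-isPermutation m _ (to ∈-Perms⇔ π∈))) _))
    (count-cong (Perms n) (λ π∈ → cong (_≡ᵇ ℓ) (hybrid-swapPartner (to ∈-Perms⇔ π∈) m)))

  hybridCount-const : ∀ {n} ℓ j → j ≤ℕ n → hybridCount n ℓ j ≡ hybridCount n ℓ 0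
  hybridCount-const ℓ zero    _   = refl
  hybridCount-const {n} ℓ (suc j) j<n = trans
    (subst (λ i → hybridCount n ℓ (suc i) ≡ hybridCount n ℓ i) (toℕ-fromℕ< j<n) (hybridCount-suc ℓ (fromℕ< j<n)))
    (hybridCount-const ℓ j (<⇒≤ j<n))

  equidistributed : Equidistributed P Q
  equidistributed n ℓ = begin
    numWith P n ℓ        ≡⟨ count-cong (Perms n) (λ {π} _ → cong (_≡ᵇ ℓ) (sym (hybrid-n π))) ⟩
    hybridCount n ℓ n    ≡⟨ hybridCount-const ℓ n ≤-refl ⟩
    hybridCount n ℓ 0    ≡⟨ count-cong (Perms n) (λ {π} _ → cong (_≡ᵇ ℓ) (hybrid-0 π)) ⟩
    numWith Q n ℓ        ∎
    where open ≡-Reasoning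

Ts-low : All (All LowBox) Ts
Ts-low = from-yes (All.all? (All.all? λ (a , b) → a ≤? 1 ×-dec b ≤? 1) Ts)

theorem4p5 : (T : List (ℕ × ℕ)) → T ∈ Ts →
    Equidistributed (mesh 3 τ123 (C ++ T)) (mesh 3 τ132 (C ++ T))
theorem4p5 T T∈Ts = Hybrid.equidistributed (All.lookup Ts-low T∈Ts)
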